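{- Let $P:\mathcal{C}^{op}\to\mathbf{InfSL}$ be an elementary doctrine in $\mathbf{QD}$. Then the category $\mathcal{C}$ is regular. Moreover, if $P$ is also existential, every equivalence relation in $\mathcal{C}$ has a stable coequalizer.
   Context: A primary doctrine is a functor $P:\mathcal{C}^{op}\to\mathbf{InfSL}$ where $\mathcal{C}$ has finite products, each $P(A)$ is a poset with finite meets (top $\top_A$) and each $P_f$ preserves them. Write $f\times f'=\langle f\circ pr_1,f'\circ pr_2\rangle$, $\Delta_A=\langle id_A,id_A\rangle$. $P$ is elementary if each $P_{id_C\times\Delta_A}$ has a left adjoint $\exists_{id_C\times\Delta_A}$ satisfying Frobenius reciprocity; $\delta_A=\exists_{\Delta_A}(\top_A)$. $P$ is existential if for each product projection $pr$, $P_{pr}$ has a left adjoint $\exists_{pr}$ satisfying Beck–Chevalley and Frobenius reciprocity. A $P$-equivalence relation on $A$ is $\rho\in P(A\times A)$ with $\delta_A\le\rho$, $\rho\le P_{\langle pr_2,pr_1\rangle}(\rho)$, $P_{\langle pr_1,pr_2\rangle}(\rho)\wedge P_{\langle pr_2,pr_3\rangle}(\rho)\le P_{\langle pr_1,pr_3\rangle}(\rho)$. A quotient of $\rho$ is $q:A\to C$ with $\rho\le P_{q\times q}(\delta_C)$ such that every $g:A\to Z$ with $\rho\le P_{g\times g}(\delta_Z)$ factors uniquely through $q$; stable if for every $f:C'\to C$ there is a pullback $q':A'\to C'$, $f':A'\to A$ of $q$ along $f$ with $q'$ a quotient of $P_{f'\times f'}(\rho)$; effective if $P_{q\times q}(\delta_C)=\rho$.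 $\mathrm{des}(\rho)=\{\alpha\in P(A):P_{pr_1}(\alpha)\wedge\rho\le P_{pr_2}(\alpha)\}$; $f:A\to B$ is of effective descent if $P_f:P(B)\to\mathrm{des}(P_{f\times f}(\delta_B))$ is an isomorphism. A comprehension of $\alpha\in P(A)$ is $\{\alpha\}:X\to A$ with $\top_X\le P_{\{\alpha\}}(\alpha)$ such that every $g$ with $\top\le P_g(\alpha)$ factors uniquely through it; full if $\top_X\le P_{\{\alpha\}}(\beta)$ implies $\alpha\le\beta$. Comprehensive equalizers: each $\Delta_A$ is a comprehension of $\delta_A$ and all reindexings of $\delta_A$ have comprehensions. $P$ is in $\mathbf{QD}$ if it is elementary, has full comprehensions and comprehensive equalizers, and every $P$-equivalence relation has a stable effective quotient which is of effective descent. An equivalence relation in $\mathcal{C}$ is a monic $r:R\to A\times A$ that is reflexive, symmetric and transitive in the usual categorical sense. -}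

module Defs where

open import Level using (Level; _⊔_) renaming (suc to lsuc)
open import Data.Product using (Σ; _×_; _,_)
open import Relation.Binary.PropositionalEquality using (_≡_)

Unique : ∀ {a b} {A : Set a} (P : A → Set b) → Set (a ⊔ b)
Unique {A = A} P = Σ A λ x → P x × (∀ y → P y → x ≡ y)

record CartesianCategory (o ℓ : Level) : Set (lsuc (o ⊔ ℓ)) where
  infixr 9 _∘_
  infixr 7 _⊗_
  field
    Obj : Set o
    Hom : Obj → Obj → Set ℓ
    id  : ∀ {A} → Hom A A
    _∘_ : ∀ {A B C} → Hom B C → Hom A B → Hom A C
    assoc : ∀ {A B C D} {f : Hom A B} {g : Hom B C} {h : Hom C D} →
            (h ∘ g) ∘ f ≡ h ∘ (g ∘ f)
    identityˡ : ∀ {A B} {f : Hom A B} → id ∘ f ≡ f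
    identityʳ : ∀ {A B} {f : Hom A B} → f ∘ id ≡ f
    𝟙 : Obj
    ! : ∀ {A} → Hom A 𝟙
    !-unique : ∀ {A} (f : Hom A 𝟙) → f ≡ !
    _⊗_ : Obj → Obj → Obj
    π₁ : ∀ {A B} → Hom (A ⊗ B) A
    π₂ : ∀ {A B} → Hom (A ⊗ B) B
    ⟨_,_⟩ : ∀ {X A B} → Hom X A → Hom X B → Hom X (A ⊗ B)
    π₁-β : ∀ {X A B} {f : Hom X A} {g : Hom X B} → π₁ ∘ ⟨ f , g ⟩ ≡ f
    π₂-β : ∀ {X A B} {f : Hom X A} {g : Hom X B} → π₂ ∘ ⟨ f , g ⟩ ≡ g
    ⟨⟩-η : ∀ {X A B} (h : Hom X (A ⊗ B)) → ⟨ π₁ ∘ h , π₂ ∘ h ⟩ ≡ h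

  infixr 8 _⁂_
  _⁂_ : ∀ {A B A' B'} → Hom A B → Hom A' B' → Hom (A ⊗ A') (B ⊗ B')
  f ⁂ g = ⟨ f ∘ π₁ , g ∘ π₂ ⟩

  Δ : ∀ {A} → Hom A (A ⊗ A)
  Δ = ⟨ id , id ⟩

  Monic : ∀ {A B} → Hom A B → Set (o ⊔ ℓ)
  Monic {A} f = ∀ {X} (x y : Hom X A) → f ∘ x ≡ f ∘ y → x ≡ y

  IsPullback : ∀ {A B C P} → Hom A C → Hom B C → Hom P A → Hom P B → Set (o ⊔ ℓ)
  IsPullback {A} {B} f g p q =
    (f ∘ p ≡ g ∘ q) ×
    (∀ {X} (h : Hom X A) (k : Hom X B) → f ∘ h ≡ g ∘ k →
       Unique λ u → (p ∘ u ≡ h) × (q ∘ u ≡ k))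

  IsCoequalizer : ∀ {R A Q} → Hom R A → Hom R A → Hom A Q → Set (o ⊔ ℓ)
  IsCoequalizer {A = A} f g c =
    (c ∘ f ≡ c ∘ g) ×
    (∀ {Z} (h : Hom A Z) → h ∘ f ≡ h ∘ g → Unique λ u → u ∘ c ≡ h)

  RegularEpi : ∀ {A B} → Hom A B → Set (o ⊔ ℓ)
  RegularEpi {A} e = Σ Obj λ R → Σ (Hom R A) λ f → Σ (Hom R A) λ g → IsCoequalizer f g e

  -- Regular category: finite limits (terminal object and binary products
  -- are part of the structure; pullbacks are required here), coequalizers
  -- of kernel pairs, and regular epimorphisms stable under pullback.
  HasPullbacks : Set (o ⊔ ℓ)
  HasPullbacks = ∀ {A B C} (f : Hom A C) (g : Hom B C) →
    Σ Obj λ P → Σ (Hom P A) λ p → Σ (Hom P B) λ q → IsPullback f g p q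

  KernelPairsHaveCoequalizers : Set (o ⊔ ℓ)
  KernelPairsHaveCoequalizers = ∀ {A B K} (f : Hom A B) (p q : Hom K A) →
    IsPullback f f p q → Σ Obj λ Q → Σ (Hom A Q) λ c → IsCoequalizer p q c

  RegularEpisPullbackStable : Set (o ⊔ ℓ)
  RegularEpisPullbackStable = ∀ {A B C P} (e : Hom A B) (f : Hom C B)
    (p : Hom P A) (e' : Hom P C) → RegularEpi e → IsPullback e f p e' → RegularEpi e'

  Regular : Set (o ⊔ ℓ)
  Regular = HasPullbacks × KernelPairsHaveCoequalizers × RegularEpisPullbackStable

  IsEquivalenceRelation : ∀ {R A} → Hom R (A ⊗ A) → Set (o ⊔ ℓ)
  IsEquivalenceRelation {R} {A} r =
    Monic r ×
    (Σ (Hom A R) λ s → r ∘ s ≡ Δ) ×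
    (Σ (Hom R R) λ s → r ∘ s ≡ ⟨ π₂ , π₁ ⟩ ∘ r) ×
    (∀ {X} (x y : Hom X R) → π₂ ∘ r ∘ x ≡ π₁ ∘ r ∘ y →
       Σ (Hom X R) λ t → r ∘ t ≡ ⟨ π₁ ∘ r ∘ x , π₂ ∘ r ∘ y ⟩)

  -- A stable coequalizer of r : R → A × A: a coequalizer q of π₁r, π₂r such
  -- that pulling back the whole diagram R ⇉ A → Q along any f : Q' → Q
  -- yields a coequalizer diagram R' ⇉ A' → Q'.
  HasStableCoequalizer : ∀ {R A} → Hom R (A ⊗ A) → Set (o ⊔ ℓ)
  HasStableCoequalizer {R} {A} r =
    Σ Obj λ Q → Σ (Hom A Q) λ q →
      IsCoequalizer (π₁ ∘ r) (π₂ ∘ r) q ×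
      (∀ {Q' A' R'} (f : Hom Q' Q) (a : Hom A' A) (q' : Hom A' Q') →
         IsPullback q f a q' →
         (b : Hom R' R) (s : Hom R' Q') → IsPullback (q ∘ π₁ ∘ r) f b s →
         (r₁' r₂' : Hom R' A') →
         a ∘ r₁' ≡ (π₁ ∘ r) ∘ b → q' ∘ r₁' ≡ s →
         a ∘ r₂' ≡ (π₂ ∘ r) ∘ b → q' ∘ r₂' ≡ s →
         IsCoequalizer r₁' r₂' q')

  EquivalenceRelationsHaveStableCoequalizers : Set (o ⊔ ℓ)
  EquivalenceRelationsHaveStableCoequalizers =
    ∀ {R A} (r : Hom R (A ⊗ A)) → IsEquivalenceRelation r → HasStableCoequalizer r

record PrimaryDoctrine {o ℓ} (𝒞 : CartesianCategory o ℓ) (p r : Level)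
       : Set (o ⊔ ℓ ⊔ lsuc (p ⊔ r)) where
  open CartesianCategory 𝒞
  infix 4 _≤_
  infixr 6 _∧_
  field
    P : Obj → Set p
    _≤_ : ∀ {A} → P A → P A → Set r
    ≤-refl : ∀ {A} {α : P A} → α ≤ α
    ≤-trans : ∀ {A} {α β γ : P A} → α ≤ β → β ≤ γ → α ≤ γ
    ≤-antisym : ∀ {A} {α β : P A} → α ≤ β → β ≤ α → α ≡ β
    ⊤ : (A : Obj) → P A
    ⊤-max : ∀ {A} (α : P A) → α ≤ ⊤ A
    _∧_ : ∀ {A} → P A → P A → P A
    ∧-lb₁ : ∀ {A} (α β : P A) → α ∧ β ≤ α
    ∧-lb₂ : ∀ {A} (α β : P A) → α ∧ β ≤ β
    ∧-glb : ∀ {A} {α β γ : P A} → γ ≤ α → γ ≤ β → γ ≤ α ∧ β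
    re : ∀ {A B} → Hom A B → P B → P A
    re-mono : ∀ {A B} (f : Hom A B) {α β : P B} → α ≤ β → re f α ≤ re f β
    re-⊤ : ∀ {A B} (f : Hom A B) → re f (⊤ B) ≡ ⊤ A
    re-∧ : ∀ {A B} (f : Hom A B) (α β : P B) → re f (α ∧ β) ≡ re f α ∧ re f β
    re-id : ∀ {A} (α : P A) → re id α ≡ α
    re-∘ : ∀ {A B C} (f : Hom A B) (g : Hom B C) (α : P C) → re (g ∘ f) α ≡ re f (re g α)

module _ {o ℓ p r} {𝒞 : CartesianCategory o ℓ} (D : PrimaryDoctrine 𝒞 p r) where
  open CartesianCategory 𝒞
  open PrimaryDoctrine D

  record Elementary : Set (o ⊔ ℓ ⊔ p ⊔ r) where
    field
      ∃Δ : ∀ {C A} → P (C ⊗ A) → P (C ⊗ (A ⊗ A))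
      ∃Δ-unit : ∀ {C A} (α : P (C ⊗ A)) (β : P (C ⊗ (A ⊗ A))) →
                ∃Δ α ≤ β → α ≤ re (id {C} ⁂ Δ {A}) β
      ∃Δ-counit : ∀ {C A} (α : P (C ⊗ A)) (β : P (C ⊗ (A ⊗ A))) →
                α ≤ re (id {C} ⁂ Δ {A}) β → ∃Δ α ≤ β
      ∃Δ-frobenius : ∀ {C A} (α : P (C ⊗ A)) (β : P (C ⊗ (A ⊗ A))) →
                ∃Δ (α ∧ re (id {C} ⁂ Δ {A}) β) ≡ ∃Δ α ∧ β

  record Existential : Set (o ⊔ ℓ ⊔ p ⊔ r) where
    field
      ∃₁ : ∀ {A B} → P (A ⊗ B) → P A
      ∃₁-unit : ∀ {A B} (α : P (A ⊗ B)) (β : P A) → ∃₁ α ≤ β → α ≤ re π₁ β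
      ∃₁-counit : ∀ {A B} (α : P (A ⊗ B)) (β : P A) → α ≤ re π₁ β → ∃₁ α ≤ β
      ∃₁-BC : ∀ {A A' B} (f : Hom A' A) (α : P (A ⊗ B)) →
              re f (∃₁ α) ≡ ∃₁ (re (f ⁂ id {B}) α)
      ∃₁-frobenius : ∀ {A B} (α : P (A ⊗ B)) (β : P A) →
              ∃₁ (α ∧ re π₁ β) ≡ ∃₁ α ∧ β
      ∃₂ : ∀ {A B} → P (A ⊗ B) → P B
      ∃₂-unit : ∀ {A B} (α : P (A ⊗ B)) (β : P B) → ∃₂ α ≤ β → α ≤ re π₂ β
      ∃₂-counit : ∀ {A B} (α : P (A ⊗ B)) (β : P B) → α ≤ re π₂ β → ∃₂ α ≤ β
      ∃₂-BC : ∀ {A B B'} (f : Hom B' B) (α : P (A ⊗ B)) →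
              re f (∃₂ α) ≡ ∃₂ (re (id {A} ⁂ f) α)
      ∃₂-frobenius : ∀ {A B} (α : P (A ⊗ B)) (β : P B) →
              ∃₂ (α ∧ re π₂ β) ≡ ∃₂ α ∧ β

  module _ (E : Elementary) where
    open Elementary E

    -- δ_A = ∃_{Δ_A}(⊤_A), computed as ∃_{id_1 × Δ_A}(⊤) transported along
    -- the isomorphism ⟨!, id⟩ : A × A ≅ 1 × (A × A).
    δ : (A : Obj) → P (A ⊗ A)
    δ A = re ⟨ ! , id ⟩ (∃Δ {𝟙} {A} (⊤ (𝟙 ⊗ A)))

    IsPEquivalence : ∀ {A} → P (A ⊗ A) → Set r
    IsPEquivalence {A} ρ =
      (δ A ≤ ρ) ×
      (ρ ≤ re ⟨ π₂ , π₁ ⟩ ρ) ×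
      (re ⟨ p₁ , p₂ ⟩ ρ ∧ re ⟨ p₂ , p₃ ⟩ ρ ≤ re ⟨ p₁ , p₃ ⟩ ρ)
      where
        p₁ : Hom (A ⊗ (A ⊗ A)) A
        p₁ = π₁
        p₂ : Hom (A ⊗ (A ⊗ A)) A
        p₂ = π₁ ∘ π₂
        p₃ : Hom (A ⊗ (A ⊗ A)) A
        p₃ = π₂ ∘ π₂

    IsQuotient : ∀ {A C} → P (A ⊗ A) → Hom A C → Set (o ⊔ ℓ ⊔ r)
    IsQuotient {A} {C} ρ q =
      (ρ ≤ re (q ⁂ q) (δ C)) ×
      (∀ {Z} (g : Hom A Z) → ρ ≤ re (g ⁂ g) (δ Z) → Unique λ u → u ∘ q ≡ g)

    IsStableQuotient : ∀ {A C} → P (A ⊗ A) → Hom A C → Set (o ⊔ ℓ ⊔ r)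
    IsStableQuotient {A} {C} ρ q =
      IsQuotient ρ q ×
      (∀ {C'} (f : Hom C' C) →
        Σ Obj λ A' → Σ (Hom A' C') λ q' → Σ (Hom A' A) λ f' →
          IsPullback q f f' q' × IsQuotient (re (f' ⁂ f') ρ) q')

    IsEffective : ∀ {A C} → P (A ⊗ A) → Hom A C → Set p
    IsEffective {C = C} ρ q = re (q ⁂ q) (δ C) ≡ ρ

    des : ∀ {A} → P (A ⊗ A) → P A → Set r
    des ρ α = re π₁ α ∧ ρ ≤ re π₂ α

    -- P_f : P(B) → des(P_{f×f}(δ_B)) is an isomorphism of posets
    IsEffectiveDescent : ∀ {A B} → Hom A B → Set (p ⊔ r)
    IsEffectiveDescent {A} {B} f =
      (∀ (β : P B) → des (re (f ⁂ f) (δ B)) (re f β)) ×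
      (∀ (β β' : P B) → re f β ≤ re f β' → β ≤ β') ×
      (∀ (α : P A) → des (re (f ⁂ f) (δ B)) α → Σ (P B) λ β → re f β ≡ α)

    IsComprehension : ∀ {A X} → P A → Hom X A → Set (o ⊔ ℓ ⊔ r)
    IsComprehension {A} {X} α c =
      (⊤ X ≤ re c α) ×
      (∀ {Y} (g : Hom Y A) → ⊤ Y ≤ re g α → Unique λ h → c ∘ h ≡ g)

    IsFull : ∀ {A X} → P A → Hom X A → Set (p ⊔ r)
    IsFull {A} {X} α c = ∀ (β : P A) → ⊤ X ≤ re c β → α ≤ β

    HasFullComprehensions : Set (o ⊔ ℓ ⊔ p ⊔ r)
    HasFullComprehensions = ∀ {A} (α : P A) →
      Σ Obj λ X → Σ (Hom X A) λ c → IsComprehension α c × IsFull α c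

    HasComprehensiveEqualizers : Set (o ⊔ ℓ ⊔ r)
    HasComprehensiveEqualizers =
      (∀ (A : Obj) → IsComprehension (δ A) (Δ {A})) ×
      (∀ {A Y} (f : Hom Y (A ⊗ A)) →
         Σ Obj λ X → Σ (Hom X Y) λ c → IsComprehension (re f (δ A)) c)

    InQD : Set (o ⊔ ℓ ⊔ p ⊔ r)
    InQD =
      HasFullComprehensions ×
      HasComprehensiveEqualizers ×
      (∀ {A} (ρ : P (A ⊗ A)) → IsPEquivalence ρ →
         Σ Obj λ C → Σ (Hom A C) λ q →
           IsStableQuotient ρ q × IsEffective ρ q × IsEffectiveDescent q)

-- By full comprehensions a predicate is determined by the generalised elements k at which
-- it holds (⊤ ≤ P_k), and by comprehensive equalizers δ holds at ⟨x , y⟩ exactly when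
-- x ≡ y; so the doctrine can be reasoned about like a logic of equations. The comprehension
-- of P_{f×g}(δ) is then a pullback of f and g, and the kernel P_{f×f}(δ) of any arrow is a
-- P-equivalence whose quotient coequalizes every kernel pair of f. A regular epi e is a
-- quotient of its kernel, hence isomorphic to the stable quotient of that kernel, so each
-- pullback of e is again a quotient and thus a regular epi. If P is existential, an
-- equivalence relation r yields the P-equivalence ∃₂ P_{r×id}(δ), the least predicate
-- holding at r, and its stable quotient is a stable coequalizer of r.
module Submission where

open import Data.Product using (Σ; _×_; _,_; proj₁; proj₂)
open import Relation.Binary.PropositionalEquality
  using (_≡_; refl; sym; trans; cong; cong₂; subst; subst₂; module ≡-Reasoning)
open import Defs

module CartesianReasoning {o ℓ} (𝒞 : CartesianCategory o ℓ) where
  open CartesianCategory 𝒞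
  open ≡-Reasoning

  private variable
    A B C P Q X Y : Obj

  pullˡ : {f : Hom B C} {g : Hom A B} {h : Hom A C} {k : Hom X A} →
          f ∘ g ≡ h → f ∘ g ∘ k ≡ h ∘ k
  pullˡ {k = k} e = trans (sym assoc) (cong (_∘ k) e)

  cancelˡ : {f : Hom B A} {g : Hom A B} {k : Hom X A} → f ∘ g ≡ id → f ∘ g ∘ k ≡ k
  cancelˡ e = trans (pullˡ e) identityˡ

  ⟨⟩-unique : {h h' : Hom X (A ⊗ B)} → π₁ ∘ h ≡ π₁ ∘ h' → π₂ ∘ h ≡ π₂ ∘ h' → h ≡ h'
  ⟨⟩-unique {h = h} {h'} e₁ e₂ = trans (sym (⟨⟩-η h)) (trans (cong₂ ⟨_,_⟩ e₁ e₂) (⟨⟩-η h'))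

  ⟨⟩-injective : {a c : Hom X A} {b d : Hom X B} → ⟨ a , b ⟩ ≡ ⟨ c , d ⟩ → a ≡ c × b ≡ d
  ⟨⟩-injective e =
    trans (sym π₁-β) (trans (cong (π₁ ∘_) e) π₁-β) , trans (sym π₂-β) (trans (cong (π₂ ∘_) e) π₂-β)

  ⟨⟩∘ : {f : Hom Y A} {g : Hom Y B} {h : Hom X Y} → ⟨ f , g ⟩ ∘ h ≡ ⟨ f ∘ h , g ∘ h ⟩
  ⟨⟩∘ = ⟨⟩-unique (trans (pullˡ π₁-β) (sym π₁-β)) (trans (pullˡ π₂-β) (sym π₂-β))

  Δ∘ : {f : Hom X A} → Δ ∘ f ≡ ⟨ f , f ⟩
  Δ∘ = trans ⟨⟩∘ (cong₂ ⟨_,_⟩ identityˡ identityˡ)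

  swap∘⟨⟩ : {f : Hom X A} {g : Hom X B} → ⟨ π₂ , π₁ ⟩ ∘ ⟨ f , g ⟩ ≡ ⟨ g , f ⟩
  swap∘⟨⟩ = trans ⟨⟩∘ (cong₂ ⟨_,_⟩ π₂-β π₁-β)

  ⁂∘⟨⟩ : {f : Hom A C} {g : Hom B P} {x : Hom X A} {y : Hom X B} →
         (f ⁂ g) ∘ ⟨ x , y ⟩ ≡ ⟨ f ∘ x , g ∘ y ⟩
  ⁂∘⟨⟩ = trans ⟨⟩∘ (cong₂ ⟨_,_⟩ (trans assoc (cong (_ ∘_) π₁-β)) (trans assoc (cong (_ ∘_) π₂-β)))

  ⁂∘⁂ : {f : Hom B C} {g : Hom Q P} {f' : Hom A B} {g' : Hom X Q} →
        (f ⁂ g) ∘ (f' ⁂ g') ≡ (f ∘ f') ⁂ (g ∘ g')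
  ⁂∘⁂ = trans ⁂∘⟨⟩ (cong₂ ⟨_,_⟩ (sym assoc) (sym assoc))

  IsIso : Hom A B → Set ℓ
  IsIso {A} {B} w = Σ (Hom B A) λ w⁻¹ → (w ∘ w⁻¹ ≡ id) × (w⁻¹ ∘ w ≡ id)

  split-monic : {u : Hom B A} {v : Hom A B} → u ∘ v ≡ id → Monic v
  split-monic {u = u} {v} uv≡id x y e = begin
    x              ≡⟨ sym (cancelˡ uv≡id) ⟩
    u ∘ v ∘ x      ≡⟨ cong (u ∘_) e ⟩
    u ∘ v ∘ y      ≡⟨ cancelˡ uv≡id ⟩
    y              ∎

  pullback-ext : {f : Hom A C} {g : Hom B C} {p : Hom P A} {q : Hom P B} →
                 IsPullback f g p q → (x y : Hom X P) → p ∘ x ≡ p ∘ y → q ∘ x ≡ q ∘ y → x ≡ y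
  pullback-ext {p = p} {q} (square , universal) x y e₁ e₂ =
    let (_ , _ , unique) = universal (p ∘ x) (q ∘ x) (trans (pullˡ square) assoc)
    in trans (sym (unique x (refl , refl))) (unique y (sym e₁ , sym e₂))

  pullback-iso : {f : Hom A C} {g : Hom B C} {p : Hom P A} {q : Hom P B}
                 {p' : Hom Q A} {q' : Hom Q B} →
                 IsPullback f g p q → IsPullback f g p' q' →
                 Σ (Hom P Q) λ w → IsIso w × (p' ∘ w ≡ p) × (q' ∘ w ≡ q)
  pullback-iso {p = p} {q} {p'} {q'} pb pb' =
    let (w  , (p'w≡p  , q'w≡q)  , _) = proj₂ pb' p q (proj₁ pb)
        (w' , (pw'≡p' , qw'≡q') , _) = proj₂ pb p' q' (proj₁ pb')
    in w , (w' , round-trip pb' p'w≡p q'w≡q pw'≡p' qw'≡q'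
               , round-trip pb pw'≡p' qw'≡q' p'w≡p q'w≡q) , p'w≡p , q'w≡q
    where
      round-trip : ∀ {A B C P Q} {f : Hom A C} {g : Hom B C} {p : Hom P A} {q : Hom P B}
                   {p' : Hom Q A} {q' : Hom Q B} {w : Hom Q P} {w' : Hom P Q} → IsPullback f g p q →
                   p ∘ w ≡ p' → q ∘ w ≡ q' → p' ∘ w' ≡ p → q' ∘ w' ≡ q → w ∘ w' ≡ id
      round-trip pb e₁ e₂ e₃ e₄ =
        pullback-ext pb _ id (trans (pullˡ e₁) (trans e₃ (sym identityʳ)))
                             (trans (pullˡ e₂) (trans e₄ (sym identityʳ)))

  pullback-postcompose-monic : {f : Hom A C} {g : Hom B C} {p : Hom P A} {q : Hom P B} {m : Hom C Q} →
                               Monic m → IsPullback f g p q → IsPullback (m ∘ f) (m ∘ g) p q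
  pullback-postcompose-monic {m = m} monic (square , universal) =
    trans assoc (trans (cong (m ∘_) square) (sym assoc)) ,
    λ h k e → universal h k (monic _ _ (trans (sym assoc) (trans e assoc)))

module DoctrineLogic {o ℓ p r} {𝒞 : CartesianCategory o ℓ} (D : PrimaryDoctrine 𝒞 p r) where
  open CartesianCategory 𝒞
  open PrimaryDoctrine D
  open CartesianReasoning 𝒞

  private variable
    A B C X Y Z : Obj

  Holds : Hom Y A → P A → Set r
  Holds {Y} k α = ⊤ Y ≤ re k α

  holds-resp : {k k' : Hom Y A} {α : P A} → k ≡ k' → Holds k α → Holds k' α
  holds-resp {α = α} e = subst (λ k → Holds k α) e

  holds-mono : {k : Hom Y A} {α β : P A} → α ≤ β → Holds k α → Holds k β
  holds-mono {k = k} α≤β h = ≤-trans h (re-mono k α≤β)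

  holds-∘ : {k : Hom Y A} {α : P A} (t : Hom X Y) → Holds k α → Holds (k ∘ t) α
  holds-∘ {k = k} {α} t h =
    subst (⊤ _ ≤_) (sym (re-∘ t k α))
      (≤-trans (subst (⊤ _ ≤_) (sym (re-⊤ t)) ≤-refl) (re-mono t h))

  re-holds⁺ : {k : Hom Y A} {g : Hom A B} {α : P B} → Holds (g ∘ k) α → Holds k (re g α)
  re-holds⁺ {k = k} {g} {α} = subst (⊤ _ ≤_) (re-∘ k g α)

  re-holds⁻ : {k : Hom Y A} {g : Hom A B} {α : P B} → Holds k (re g α) → Holds (g ∘ k) α
  re-holds⁻ {k = k} {g} {α} = subst (⊤ _ ≤_) (sym (re-∘ k g α))

  ⁂-holds⁺ : {f : Hom A C} {g : Hom B Z} {x : Hom Y A} {y : Hom Y B} {α : P (C ⊗ Z)} →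
             Holds ⟨ f ∘ x , g ∘ y ⟩ α → Holds ⟨ x , y ⟩ (re (f ⁂ g) α)
  ⁂-holds⁺ h = re-holds⁺ (holds-resp (sym ⁂∘⟨⟩) h)

  ⁂-holds⁻ : {f : Hom A C} {g : Hom B Z} {x : Hom Y A} {y : Hom Y B} {α : P (C ⊗ Z)} →
             Holds ⟨ x , y ⟩ (re (f ⁂ g) α) → Holds ⟨ f ∘ x , g ∘ y ⟩ α
  ⁂-holds⁻ h = holds-resp ⁂∘⟨⟩ (re-holds⁻ h)

  ⟨⟩-holds⁺ : {a : Hom X A} {b : Hom X B} {k : Hom Y X} {α : P (A ⊗ B)} →
              Holds ⟨ a ∘ k , b ∘ k ⟩ α → Holds k (re ⟨ a , b ⟩ α)
  ⟨⟩-holds⁺ h = re-holds⁺ (holds-resp (sym ⟨⟩∘) h)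

  ⟨⟩-holds⁻ : {a : Hom X A} {b : Hom X B} {k : Hom Y X} {α : P (A ⊗ B)} →
              Holds k (re ⟨ a , b ⟩ α) → Holds ⟨ a ∘ k , b ∘ k ⟩ α
  ⟨⟩-holds⁻ h = holds-resp ⟨⟩∘ (re-holds⁻ h)

module ComprehensionLogic {o ℓ p r} {𝒞 : CartesianCategory o ℓ} {D : PrimaryDoctrine 𝒞 p r}
  (E : Elementary D) (full : HasFullComprehensions D E) (equalizers : HasComprehensiveEqualizers D E) where
  open CartesianCategory 𝒞
  open PrimaryDoctrine D
  open CartesianReasoning 𝒞
  open DoctrineLogic D
  open ≡-Reasoning

  private variable
    A B C Q X Y : Obj

  ≤-by-elements : {α β : P A} → (∀ {Y} (k : Hom Y A) → Holds k α → Holds k β) → α ≤ β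
  ≤-by-elements {α = α} {β} H =
    let (_ , c , (c-holds , _) , c-full) = full α in c-full β (H c c-holds)

  ≤-by-pairs : {α β : P (A ⊗ B)} →
               (∀ {Y} (x : Hom Y A) (y : Hom Y B) → Holds ⟨ x , y ⟩ α → Holds ⟨ x , y ⟩ β) → α ≤ β
  ≤-by-pairs H = ≤-by-elements λ k h →
    holds-resp (⟨⟩-η k) (H (π₁ ∘ k) (π₂ ∘ k) (holds-resp (sym (⟨⟩-η k)) h))

  δ-holds⁺ : {x y : Hom Y A} → x ≡ y → Holds ⟨ x , y ⟩ (δ D E A)
  δ-holds⁺ {A = A} refl = holds-resp Δ∘ (holds-∘ _ (proj₁ (proj₁ equalizers A)))

  δ-holds⁻ : {x y : Hom Y A} → Holds ⟨ x , y ⟩ (δ D E A) → x ≡ y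
  δ-holds⁻ {A = A} h =
    let (u , Δu≡⟨x,y⟩ , _) = proj₂ (proj₁ equalizers A) _ h
        (u≡x , u≡y) = ⟨⟩-injective (trans (sym Δ∘) Δu≡⟨x,y⟩)
    in trans (sym u≡x) u≡y

  ⁂-δ-holds⁺ : {f : Hom A C} {g : Hom B C} {x : Hom Y A} {y : Hom Y B} →
               f ∘ x ≡ g ∘ y → Holds ⟨ x , y ⟩ (re (f ⁂ g) (δ D E C))
  ⁂-δ-holds⁺ e = ⁂-holds⁺ (δ-holds⁺ e)

  ⁂-δ-holds⁻ : {f : Hom A C} {g : Hom B C} {x : Hom Y A} {y : Hom Y B} →
               Holds ⟨ x , y ⟩ (re (f ⁂ g) (δ D E C)) → f ∘ x ≡ g ∘ y
  ⁂-δ-holds⁻ h = δ-holds⁻ (⁂-holds⁻ h)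

  ker : Hom A B → P (A ⊗ A)
  ker f = re (f ⁂ f) (δ D E _)

  isPEquivalence : {ρ : P (A ⊗ A)} →
    (∀ {Y} (x : Hom Y A) → Holds ⟨ x , x ⟩ ρ) →
    (∀ {Y} {x y : Hom Y A} → Holds ⟨ x , y ⟩ ρ → Holds ⟨ y , x ⟩ ρ) →
    (∀ {Y} {x y z : Hom Y A} → Holds ⟨ x , y ⟩ ρ → Holds ⟨ y , z ⟩ ρ → Holds ⟨ x , z ⟩ ρ) →
    IsPEquivalence D E ρ
  isPEquivalence {ρ = ρ} reflexive symmetric transitive =
    ≤-by-pairs (λ x y h → subst (λ z → Holds ⟨ x , z ⟩ ρ) (δ-holds⁻ h) (reflexive x)) ,
    ≤-by-pairs (λ x y h → re-holds⁺ (holds-resp (sym swap∘⟨⟩) (symmetric h))) ,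
    ≤-by-elements λ k h → ⟨⟩-holds⁺ (transitive (⟨⟩-holds⁻ (holds-mono (∧-lb₁ _ _) h))
                                                (⟨⟩-holds⁻ (holds-mono (∧-lb₂ _ _) h)))

  ker-isPEquivalence : (f : Hom A B) → IsPEquivalence D E (ker f)
  ker-isPEquivalence f =
    isPEquivalence (λ x → ⁂-δ-holds⁺ refl)
                   (λ h → ⁂-δ-holds⁺ (sym (⁂-δ-holds⁻ h)))
                   (λ h h' → ⁂-δ-holds⁺ (trans (⁂-δ-holds⁻ h) (⁂-δ-holds⁻ h')))

  hasPullbacks : HasPullbacks
  hasPullbacks f g =
    let (X , c , c-holds , universal) = proj₂ equalizers (f ⁂ g)
        holds-pair = holds-resp (sym (⟨⟩-η c)) c-holds
    in X , π₁ ∘ c , π₂ ∘ c , ⁂-δ-holds⁻ holds-pair ,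
       λ h k e →
         let (u , cu≡⟨h,k⟩ , unique) = universal ⟨ h , k ⟩ (⁂-δ-holds⁺ e)
             (π₁cu≡h , π₂cu≡k) = ⟨⟩-injective (trans (⟨⟩-η (c ∘ u)) cu≡⟨h,k⟩)
         in u , (trans assoc π₁cu≡h , trans assoc π₂cu≡k) ,
            λ u' (e₁ , e₂) → unique u' (⟨⟩-unique (trans (sym assoc) (trans e₁ (sym π₁-β)))
                                                   (trans (sym assoc) (trans e₂ (sym π₂-β))))

  quotient⇒coequalizer : {ρ : P (A ⊗ A)} {q : Hom A Q} {x y : Hom X A} →
    IsQuotient D E ρ q → Holds ⟨ x , y ⟩ ρ →
    (∀ {Z} (h : Hom A Z) → h ∘ x ≡ h ∘ y → ρ ≤ ker h) →
    IsCoequalizer x y q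
  quotient⇒coequalizer (ρ≤ker-q , factor) h-xy coequalized =
    ⁂-δ-holds⁻ (holds-mono ρ≤ker-q h-xy) , λ h e → factor h (coequalized h e)

  quotient⇒regularEpi : {ρ : P (A ⊗ A)} {q : Hom A Q} → IsQuotient D E ρ q → RegularEpi q
  quotient⇒regularEpi {ρ = ρ} quotient =
    let (X , c , (c-holds , _) , c-full) = full ρ
    in X , π₁ ∘ c , π₂ ∘ c ,
       quotient⇒coequalizer quotient (holds-resp (sym (⟨⟩-η c)) c-holds)
         λ h e → c-full (ker h) (holds-resp (⟨⟩-η c) (⁂-δ-holds⁺ e))

  regularEpi⇒quotient : {e : Hom A B} → RegularEpi e → IsQuotient D E (ker e) e
  regularEpi⇒quotient (_ , f , g , ef≡eg , universal) =
    ≤-refl , λ h ker-e≤ker-h → universal h (⁂-δ-holds⁻ (holds-mono ker-e≤ker-h (⁂-δ-holds⁺ ef≡eg)))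

  quotient-comparison : {ρ : P (A ⊗ A)} {e : Hom A B} {q : Hom A Q} →
    IsQuotient D E ρ e → IsQuotient D E ρ q → Σ (Hom B Q) λ v → (v ∘ e ≡ q) × Monic v
  quotient-comparison {e = e} {q} (ρ≤ker-e , factor-e) (ρ≤ker-q , factor-q) =
    let (v , ve≡q , _) = factor-e q ρ≤ker-q
        (u , uq≡e , _) = factor-q e ρ≤ker-e
        (_ , _ , unique) = factor-e e ρ≤ker-e
        uv≡id = trans (sym (unique (u ∘ v) (trans assoc (trans (cong (u ∘_) ve≡q) uq≡e))))
                      (unique id identityˡ)
    in v , ve≡q , split-monic uv≡id

  quotient-∘-iso : {ρ : P (A ⊗ A)} {q : Hom A Q} {w : Hom B A} →
    IsQuotient D E ρ q → IsIso w → IsQuotient D E (re (w ⁂ w) ρ) (q ∘ w)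
  quotient-∘-iso {ρ = ρ} {q} {w} (ρ≤ker-q , factor) (w⁻¹ , ww⁻¹≡id , w⁻¹w≡id) =
    ≤-by-pairs (λ x y h → ⁂-δ-holds⁺ (trans assoc (trans (⁂-δ-holds⁻ (holds-mono ρ≤ker-q (⁂-holds⁻ h)))
                                                         (sym assoc)))) ,
    λ g ≤ker-g →
      let (u , uq≡gw⁻¹ , unique) = factor (g ∘ w⁻¹) (ρ≤ker-gw⁻¹ g ≤ker-g)
      in u , (begin
               u ∘ q ∘ w          ≡⟨ pullˡ uq≡gw⁻¹ ⟩
               (g ∘ w⁻¹) ∘ w      ≡⟨ trans assoc (cong (g ∘_) w⁻¹w≡id) ⟩
               g ∘ id             ≡⟨ identityʳ ⟩
               g                  ∎) ,
         λ u' u'qw≡g → unique u' (begin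
               u' ∘ q             ≡⟨ sym (trans (cong ((u' ∘ q) ∘_) ww⁻¹≡id) identityʳ) ⟩
               (u' ∘ q) ∘ w ∘ w⁻¹ ≡⟨ pullˡ (trans assoc u'qw≡g) ⟩
               g ∘ w⁻¹            ∎)
    where
      ρ≤ker-gw⁻¹ : ∀ {Z} (g : Hom _ Z) → re (w ⁂ w) ρ ≤ ker g → ρ ≤ ker (g ∘ w⁻¹)
      ρ≤ker-gw⁻¹ g ≤ker-g = ≤-by-pairs λ x y h →
        let h' = holds-resp (cong₂ ⟨_,_⟩ (sym (cancelˡ ww⁻¹≡id)) (sym (cancelˡ ww⁻¹≡id))) h
        in ⁂-δ-holds⁺ (trans assoc (trans (⁂-δ-holds⁻ (holds-mono ≤ker-g (⁂-holds⁺ h'))) (sym assoc)))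

  stableQuotient-pullback : {ρ : P (A ⊗ A)} {q : Hom A Q} {f : Hom C Q} {a : Hom B A} {q' : Hom B C} →
    IsStableQuotient D E ρ q → IsPullback q f a q' → IsQuotient D E (re (a ⁂ a) ρ) q'
  stableQuotient-pullback {ρ = ρ} {f = f} {a} (_ , stable) pb =
    let (_ , q'' , f'' , pb'' , quotient'') = stable f
        (w , w-iso , f''w≡a , q''w≡q') = pullback-iso pb pb''
        reindex = begin
          re (w ⁂ w) (re (f'' ⁂ f'') ρ)   ≡⟨ sym (re-∘ _ _ ρ) ⟩
          re ((f'' ⁂ f'') ∘ (w ⁂ w)) ρ    ≡⟨ cong (λ g → re g ρ) ⁂∘⁂ ⟩
          re ((f'' ∘ w) ⁂ (f'' ∘ w)) ρ    ≡⟨ cong (λ g → re (g ⁂ g) ρ) f''w≡a ⟩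
          re (a ⁂ a) ρ                    ∎
    in subst₂ (IsQuotient D E) reindex q''w≡q' (quotient-∘-iso quotient'' w-iso)

  module Images (existential : Existential D) where
    open Existential existential

    image : Hom Y B → P B
    image r = ∃₂ (re (r ⁂ id) (δ D E _))

    image-holds⁺ : {r : Hom Y B} {k : Hom X B} (n : Hom X Y) → r ∘ n ≡ k → Holds k (image r)
    image-holds⁺ {r = r} n e =
      holds-resp π₂-β (re-holds⁻ (holds-mono (∃₂-unit _ (image r) ≤-refl)
                                            (⁂-δ-holds⁺ (trans e (sym identityˡ)))))

    image-holds⁻ : {r : Hom Y B} {k : Hom X B} {m : Hom X C} {β : P C} → Holds k (image r) →
      (∀ {Z} (n : Hom Z Y) (t : Hom Z X) → r ∘ n ≡ k ∘ t → Holds (m ∘ t) β) → Holds m β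
    image-holds⁻ {r = r} {k} {m} {β} h H =
      ≤-trans (subst (⊤ _ ≤_) (∃₂-BC k _) h)
              (∃₂-counit _ (re m β) (≤-by-pairs λ n t h' →
                 re-holds⁺ (holds-resp (sym π₂-β) (re-holds⁺ (H n t (witness h'))))))
      where
        witness : ∀ {Z} {n : Hom Z _} {t : Hom Z _} →
                  Holds ⟨ n , t ⟩ (re (id ⁂ k) (re (r ⁂ id) (δ D E _))) → r ∘ n ≡ k ∘ t
        witness h' = trans (cong (r ∘_) (sym identityˡ))
                           (trans (⁂-δ-holds⁻ (⁂-holds⁻ h')) identityˡ)

    image-least : {r : Hom Y B} {β : P B} → Holds r β → image r ≤ β
    image-least r-holds = ≤-by-elements λ k h →
      image-holds⁻ h λ n t e → holds-resp e (holds-∘ n r-holds)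

    module _ {R A} {rel : Hom R (A ⊗ A)} (equivalence : IsEquivalenceRelation rel) where
      private
        ρ : P (A ⊗ A)
        ρ = image rel

        rel-holds : Holds ⟨ π₁ ∘ rel , π₂ ∘ rel ⟩ ρ
        rel-holds = holds-resp (sym (⟨⟩-η rel)) (image-holds⁺ id identityʳ)

        rel-trans : ∀ {Y} {u v : Hom Y R} {a b c : Hom Y A} →
                    rel ∘ u ≡ ⟨ a , b ⟩ → rel ∘ v ≡ ⟨ b , c ⟩ → Σ (Hom Y R) λ w → rel ∘ w ≡ ⟨ a , c ⟩
        rel-trans {u = u} {v} e₁ e₂ =
          let (_ , _ , _ , transitive) = equivalence
              (w , e) = transitive u v (trans (cong (π₂ ∘_) e₁) (trans π₂-β (sym (trans (cong (π₁ ∘_) e₂) π₁-β))))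
          in w , trans e (cong₂ ⟨_,_⟩ (trans (cong (π₁ ∘_) e₁) π₁-β) (trans (cong (π₂ ∘_) e₂) π₂-β))

      image-isPEquivalence : IsPEquivalence D E ρ
      image-isPEquivalence = isPEquivalence reflexive symmetric transitive
        where
          reflexive : ∀ {Y} (x : Hom Y A) → Holds ⟨ x , x ⟩ ρ
          reflexive x =
            let (_ , (s , rel∘s≡Δ) , _) = equivalence
            in image-holds⁺ (s ∘ x) (trans (pullˡ rel∘s≡Δ) Δ∘)

          symmetric : ∀ {Y} {x y : Hom Y A} → Holds ⟨ x , y ⟩ ρ → Holds ⟨ y , x ⟩ ρ
          symmetric {x = x} {y} h = image-holds⁻ h λ n t e →
            let (_ , _ , (s , rel∘s≡swap∘rel) , _) = equivalence
            in image-holds⁺ (s ∘ n) (begin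
                 rel ∘ s ∘ n                    ≡⟨ trans (pullˡ rel∘s≡swap∘rel) assoc ⟩
                 ⟨ π₂ , π₁ ⟩ ∘ rel ∘ n           ≡⟨ cong (⟨ π₂ , π₁ ⟩ ∘_) e ⟩
                 ⟨ π₂ , π₁ ⟩ ∘ ⟨ x , y ⟩ ∘ t     ≡⟨ pullˡ swap∘⟨⟩ ⟩
                 ⟨ y , x ⟩ ∘ t                   ∎)

          transitive : ∀ {Y} {x y z : Hom Y A} → Holds ⟨ x , y ⟩ ρ → Holds ⟨ y , z ⟩ ρ → Holds ⟨ x , z ⟩ ρ
          transitive {x = x} {y} {z} hxy hyz =
            image-holds⁻ hxy λ n t e₁ →
            image-holds⁻ (holds-∘ t hyz) λ n' t' e₂ →
              let (w , rel∘w≡⟨x,z⟩) = rel-trans (trans (sym assoc) (trans (cong (_∘ t') e₁) ⟨⟩∘∘))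
                                                 (trans e₂ ⟨⟩∘∘)
              in image-holds⁺ w (trans rel∘w≡⟨x,z⟩ (sym ⟨⟩∘∘))
            where
              ⟨⟩∘∘ : ∀ {X W} {a b : Hom Y A} {t : Hom X Y} {t' : Hom W X} →
                     (⟨ a , b ⟩ ∘ t) ∘ t' ≡ ⟨ a ∘ t ∘ t' , b ∘ t ∘ t' ⟩
              ⟨⟩∘∘ = trans assoc ⟨⟩∘

      image-coequalizer : {q : Hom A Q} → IsQuotient D E ρ q → IsCoequalizer (π₁ ∘ rel) (π₂ ∘ rel) q
      image-coequalizer quotient = quotient⇒coequalizer quotient rel-holds
        λ h e → image-least (holds-resp (⟨⟩-η rel) (⁂-δ-holds⁺ e))

      image-stableCoequalizer : {q : Hom A Q} → IsStableQuotient D E ρ q → HasStableCoequalizer rel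
      image-stableCoequalizer {Q = Q} {q} stableQuotient =
        Q , q , image-coequalizer (proj₁ stableQuotient) , pulled-back-coequalizer
        where
          pulled-back-coequalizer :
            ∀ {Q' A' R'} (f : Hom Q' Q) (a : Hom A' A) (q' : Hom A' Q') → IsPullback q f a q' →
            (b : Hom R' R) (s : Hom R' Q') → IsPullback (q ∘ π₁ ∘ rel) f b s →
            (r₁' r₂' : Hom R' A') →
            a ∘ r₁' ≡ (π₁ ∘ rel) ∘ b → q' ∘ r₁' ≡ s →
            a ∘ r₂' ≡ (π₂ ∘ rel) ∘ b → q' ∘ r₂' ≡ s →
            IsCoequalizer r₁' r₂' q'
          pulled-back-coequalizer {A' = A'} {R'} f a q' pb₁ b s pb₂ r₁' r₂' ar₁'≡ q'r₁'≡s ar₂'≡ q'r₂'≡s =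
            quotient⇒coequalizer quotient' r'-holds coequalized
            where
              quotient' : IsQuotient D E (re (a ⁂ a) ρ) q'
              quotient' = stableQuotient-pullback stableQuotient pb₁

              r'-holds : Holds ⟨ r₁' , r₂' ⟩ (re (a ⁂ a) ρ)
              r'-holds = ⁂-holds⁺ (holds-resp (trans ⟨⟩∘ (cong₂ ⟨_,_⟩ (sym ar₁'≡) (sym ar₂'≡)))
                                              (holds-∘ b rel-holds))

              lift : ∀ {Y} (rᵢ : Hom R' A') (π : Hom (A ⊗ A) A) (m : Hom Y R') (z : Hom Y A') →
                     a ∘ rᵢ ≡ (π ∘ rel) ∘ b → π ∘ rel ∘ b ∘ m ≡ a ∘ z → q' ∘ rᵢ ∘ m ≡ q' ∘ z → rᵢ ∘ m ≡ z
              lift rᵢ π m z e₁ e₂ = pullback-ext pb₁ (rᵢ ∘ m) z (trans (pullˡ e₁) (trans assoc (trans assoc e₂)))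

              -- Via the two pullbacks, a pair related by P_{a×a}(ρ) lifts to an element m of R',
              -- where h ∘ r₁' ≡ h ∘ r₂' applies.
              coequalized : ∀ {Z} (h : Hom A' Z) → h ∘ r₁' ≡ h ∘ r₂' → re (a ⁂ a) ρ ≤ ker h
              coequalized h hr₁'≡hr₂' = ≤-by-pairs λ x y hxy →
                image-holds⁻ (⁂-holds⁻ hxy) λ n t e →
                  let q'x≡q'y = ⁂-δ-holds⁻ (holds-mono (proj₁ quotient') hxy)
                      π₁reln≡ = trans (cong (π₁ ∘_) e) (trans (pullˡ π₁-β) assoc)
                      π₂reln≡ = trans (cong (π₂ ∘_) e) (trans (pullˡ π₂-β) assoc)
                      square = begin
                        (q ∘ π₁ ∘ rel) ∘ n  ≡⟨ trans assoc (cong (q ∘_) (trans assoc π₁reln≡)) ⟩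
                        q ∘ a ∘ x ∘ t       ≡⟨ pullˡ (proj₁ pb₁) ⟩
                        (f ∘ q') ∘ x ∘ t    ≡⟨ assoc ⟩
                        f ∘ q' ∘ x ∘ t      ∎
                      (m , (bm≡n , sm≡q'xt) , _) = proj₂ pb₂ n (q' ∘ x ∘ t) square
                      r₁'m≡xt = lift r₁' π₁ m (x ∘ t) ar₁'≡
                        (trans (cong (λ z → π₁ ∘ rel ∘ z) bm≡n) π₁reln≡) (trans (pullˡ q'r₁'≡s) sm≡q'xt)
                      r₂'m≡yt = lift r₂' π₂ m (y ∘ t) ar₂'≡
                        (trans (cong (λ z → π₂ ∘ rel ∘ z) bm≡n) π₂reln≡)
                        (trans (pullˡ q'r₂'≡s) (trans sm≡q'xt (trans (pullˡ q'x≡q'y) assoc)))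
                  in holds-resp (sym ⟨⟩∘) (⁂-δ-holds⁺ (begin
                       h ∘ x ∘ t       ≡⟨ cong (h ∘_) (sym r₁'m≡xt) ⟩
                       h ∘ r₁' ∘ m     ≡⟨ pullˡ hr₁'≡hr₂' ⟩
                       (h ∘ r₂') ∘ m   ≡⟨ trans assoc (cong (h ∘_) r₂'m≡yt) ⟩
                       h ∘ y ∘ t       ∎))

module QuotientDoctrine {o ℓ p r} {𝒞 : CartesianCategory o ℓ} {D : PrimaryDoctrine 𝒞 p r}
  (E : Elementary D) (qd : InQD D E) where
  open CartesianCategory 𝒞
  open PrimaryDoctrine D
  open CartesianReasoning 𝒞
  open ComprehensionLogic E (proj₁ qd) (proj₁ (proj₂ qd))
  open ≡-Reasoning

  stableQuotient : ∀ {A} (ρ : P (A ⊗ A)) → IsPEquivalence D E ρ →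
                   Σ Obj λ Q → Σ (Hom A Q) λ q → IsStableQuotient D E ρ q
  stableQuotient ρ isPE = let (Q , q , stable , _) = proj₂ (proj₂ qd) ρ isPE in Q , q , stable

  kernelPairsHaveCoequalizers : KernelPairsHaveCoequalizers
  kernelPairsHaveCoequalizers f p q pb =
    let (Q , c , (quotient , _)) = stableQuotient (ker f) (ker-isPEquivalence f)
    in Q , c , quotient⇒coequalizer quotient (⁂-δ-holds⁺ (proj₁ pb)) coequalized
    where
      coequalized : ∀ {Z} (h : Hom _ Z) → h ∘ p ≡ h ∘ q → ker f ≤ ker h
      coequalized h hp≡hq = ≤-by-pairs λ x y hxy →
        let (w , (pw≡x , qw≡y) , _) = proj₂ pb x y (⁂-δ-holds⁻ hxy)
        in ⁂-δ-holds⁺ (begin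
             h ∘ x       ≡⟨ cong (h ∘_) (sym pw≡x) ⟩
             h ∘ p ∘ w   ≡⟨ pullˡ hp≡hq ⟩
             (h ∘ q) ∘ w ≡⟨ trans assoc (cong (h ∘_) qw≡y) ⟩
             h ∘ y       ∎)

  regularEpisPullbackStable : RegularEpisPullbackStable
  regularEpisPullbackStable e k p e' regular pb =
    let (_ , q , stable) = stableQuotient (ker e) (ker-isPEquivalence e)
        (v , ve≡q , v-monic) = quotient-comparison (regularEpi⇒quotient regular) (proj₁ stable)
        pb-q = subst (λ g → IsPullback g (v ∘ k) p e') ve≡q (pullback-postcompose-monic v-monic pb)
    in quotient⇒regularEpi (stableQuotient-pullback stable pb-q)

  regular : Regular
  regular = hasPullbacks , kernelPairsHaveCoequalizers , regularEpisPullbackStable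

  equivalenceRelationsHaveStableCoequalizers : Existential D → EquivalenceRelationsHaveStableCoequalizers
  equivalenceRelationsHaveStableCoequalizers X rel equivalence =
    let open Images X
        (_ , _ , stable) = stableQuotient (image rel) (image-isPEquivalence equivalence)
    in image-stableCoequalizer equivalence stable

proposition4p15 : ∀ {o ℓ p r} (𝒞 : CartesianCategory o ℓ) (D : PrimaryDoctrine 𝒞 p r)
    (E : Elementary D) → InQD D E →
    CartesianCategory.Regular 𝒞 ×
    (Existential D → CartesianCategory.EquivalenceRelationsHaveStableCoequalizers 𝒞)
proposition4p15 𝒞 D E qd = regular , equivalenceRelationsHaveStableCoequalizers
  where open QuotientDoctrine E qd
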